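{- Let $G$ be an undirected graph with edge weight function $w:E(G)\to\mathbb{Z}_{\ge 0}$. Pick a vertex $v\in V(G)$, perform a breadth-first search from $v$, and label each vertex by its distance from $v$. For each $i\ge 0$, let $E_i$ be the set of edges joining a vertex with label $i$ to a vertex with label $i+1$, and let $r$ be the number of labels. Fix an integer $k>1$. For $i\in\{0,1,\dots,k-1\}$ let $F_i=\bigcup_{j=0}^{\lfloor (r-i)/k\rfloor}E_{i+jk}$ and let $G_i$ be the subgraph of $G$ induced by the edge set $F_i$. Then $$\sum_{i=0}^{k-1}\nu(G_i)\le 2\,\nu(G).$$
   Context: $\nu(H)$ denotes the maximum total weight of a matching in an edge-weighted graph $H$. The subgraph induced by an edge set $F$ has edge set $F$ and vertex set the endpoints of edges in $F$; $E_i=\emptyset$ for labels $i$ that do not occur. -}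

module Defs where

open import Data.Nat using (ℕ; zero; suc; _+_; _*_; _≤_; _<_)
open import Data.Fin using (Fin; zero; suc)
open import Data.Bool using (Bool; true; false; if_then_else_)
open import Data.Product using (Σ; ∃; _×_; _,_; proj₁; proj₂)
open import Data.Sum using (_⊎_)
open import Relation.Binary.PropositionalEquality using (_≡_; _≢_)
open import Relation.Nullary using (¬_)
open import Data.Unit using (⊤)

∑ : (k : ℕ) → (Fin k → ℕ) → ℕ
∑ zero    f = 0
∑ (suc k) f = f zero + ∑ k (λ i → f (suc i))

record WGraph : Set where
  field
    n      : ℕ
    m      : ℕ
    src    : Fin m → Fin n
    tgt    : Fin m → Fin n
    w      : Fin m → ℕ
    loopless : ∀ e → src e ≢ tgt e
    simple : ∀ e f → ((src e ≡ src f × tgt e ≡ tgt f) ⊎ (src e ≡ tgt f × tgt e ≡ src f)) → e ≡ f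

module _ (G : WGraph) where
  open WGraph G

  Incident : Fin m → Fin n → Set
  Incident e x = src e ≡ x ⊎ tgt e ≡ x

  Adj : Fin n → Fin n → Set
  Adj a b = ∃ λ e → (src e ≡ a × tgt e ≡ b) ⊎ (src e ≡ b × tgt e ≡ a)

  data Walk : Fin n → Fin n → ℕ → Set where
    nil  : ∀ {a} → Walk a a 0
    cons : ∀ {a b c d} → Adj a b → Walk b c d → Walk a c (suc d)

  -- u has BFS label d from v, i.e. dist(v,u) = d
  Dist : Fin n → Fin n → ℕ → Set
  Dist v u d = Walk v u d × (∀ d′ → d′ < d → ¬ Walk v u d′)

  InE : Fin n → ℕ → Fin m → Set
  InE v i e = (Dist v (src e) i × Dist v (tgt e) (suc i))
            ⊎ (Dist v (tgt e) i × Dist v (src e) (suc i))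

  -- e ∈ F_i = ⋃_{j=0}^{⌊(r-i)/k⌋} E_{i+jk}   (j ≤ ⌊(r-i)/k⌋  ⇔  i + j*k ≤ r)
  InF : Fin n → ℕ → ℕ → ℕ → Fin m → Set
  InF v r k i e = ∃ λ j → (i + j * k ≤ r) × InE v (i + j * k) e

  IsMatching : (Fin m → Bool) → Set
  IsMatching M = ∀ e f → M e ≡ true → M f ≡ true → e ≢ f → ∀ x → Incident e x → ¬ Incident f x

  weight : (Fin m → Bool) → ℕ
  weight M = ∑ m (λ e → if M e then w e else 0)

  IsNu : (Fin m → Set) → ℕ → Set
  IsNu S x = (Σ (Fin m → Bool) λ M → IsMatching M × (∀ e → M e ≡ true → S e) × weight M ≡ x)
           × (∀ M → IsMatching M → (∀ e → M e ≡ true → S e) → weight M ≤ x)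

  AllEdges : Fin m → Set
  AllEdges _ = ⊤

  NumLabels : Fin n → ℕ → Set
  NumLabels v r = ∀ d → (d < r → ∃ λ u → Dist v u d) × ((∃ λ u → Dist v u d) → d < r)

-- Let M_i be a maximum matching of G_i. An edge of E_L lies in M_i only for i ≡ L (mod k), and
-- edges that share a vertex lie in layers L, L′ with |L − L′| ≤ 1, since their common vertex has BFS
-- label L or L + 1 and also L′ or L′ + 1. Hence the edges of all M_i lying in even layers form a
-- matching of G (two of them sharing a vertex would be in the same layer, hence in the same M_i),
-- and so do those in odd layers; together these two matchings carry the weight ∑ ν(G_i).
module Submission where

open import Defs
open import Data.Bool using (Bool; true; false; _∧_; _∨_; not; if_then_else_)
open import Data.Bool.Properties using (not-¬; ¬-not)
open import Data.Empty using (⊥-elim)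
open import Data.Fin using (Fin; zero; suc; toℕ)
open import Data.Fin.Properties
  using (toℕ<n; toℕ-injective; 0≢1+n) renaming (suc-injective to Fin-suc-injective)
open import Data.Nat using (ℕ; zero; suc; _+_; _*_; _≤_; _<_; _%_)
open import Data.Nat.DivMod using ([m+kn]%n≡m%n; m<n⇒m%n≡m)
open import Data.Nat.Properties
  using (+-identityʳ; +-mono-≤; <-cmp; suc-injective; +-0-commutativeMonoid; module ≤-Reasoning)
open import Data.Product using (∃; _×_; _,_; proj₁; proj₂)
open import Data.Sum using (_⊎_; inj₁; inj₂)
open import Data.Unit using (tt)
open import Data.Vec.Functional using (foldr)
open import Function using (_∘_)
open import Relation.Binary.PropositionalEquality
open import Relation.Binary using (tri<; tri≈; tri>)
import Algebra.Properties.CommutativeMonoid.Sum +-0-commutativeMonoid as Sum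

∑≗sum : ∀ k (f : Fin k → ℕ) → ∑ k f ≡ Sum.sum f
∑≗sum zero    f = refl
∑≗sum (suc k) f = cong (f zero +_) (∑≗sum k (f ∘ suc))

∑-cong : ∀ {k} {f g : Fin k → ℕ} → f ≗ g → ∑ k f ≡ ∑ k g
∑-cong {k} {f} {g} f≗g = trans (∑≗sum k f) (trans (Sum.sum-cong-≗ f≗g) (sym (∑≗sum k g)))

∑-distrib-+ : ∀ {k} (f g : Fin k → ℕ) → ∑ k (λ i → f i + g i) ≡ ∑ k f + ∑ k g
∑-distrib-+ {k} f g = trans (∑≗sum k _)
  (trans (Sum.∑-distrib-+ f g) (sym (cong₂ _+_ (∑≗sum k f) (∑≗sum k g))))

∑-comm : ∀ {k l} (f : Fin k → Fin l → ℕ) →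
         ∑ k (λ i → ∑ l (f i)) ≡ ∑ l (λ j → ∑ k (λ i → f i j))
∑-comm {k} {l} f = begin
  ∑ k (λ i → ∑ l (f i))                 ≡⟨ ∑-cong (λ i → ∑≗sum l (f i)) ⟩
  ∑ k (λ i → Sum.sum (f i))             ≡⟨ ∑≗sum k _ ⟩
  Sum.sum (λ i → Sum.sum (f i))         ≡⟨ Sum.∑-comm f ⟩
  Sum.sum (λ j → Sum.sum (λ i → f i j)) ≡⟨ sym (∑≗sum l _) ⟩
  ∑ l (λ j → Sum.sum (λ i → f i j))     ≡⟨ ∑-cong (λ j → sym (∑≗sum k (λ i → f i j))) ⟩
  ∑ l (λ j → ∑ k (λ i → f i j))         ∎
  where open ≡-Reasoning

⋁ : ∀ {k} → (Fin k → Bool) → Bool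
⋁ = foldr _∨_ false

∑-if-false : ∀ {k} (b : Fin k → Bool) x → (∀ i → b i ≡ false) →
             ∑ k (λ i → if b i then x else 0) ≡ 0
∑-if-false {zero}  b x none = refl
∑-if-false {suc k} b x none rewrite none zero = ∑-if-false (b ∘ suc) x (none ∘ suc)

∑-if-unique : ∀ {k} (b : Fin k → Bool) x → (∀ i j → b i ≡ true → b j ≡ true → i ≡ j) →
              ∑ k (λ i → if b i then x else 0) ≡ (if ⋁ b then x else 0)
∑-if-unique {zero}  b x unique = refl
∑-if-unique {suc k} b x unique with b zero in b₀
... | true  = trans (cong (x +_) (∑-if-false (b ∘ suc) x rest-false)) (+-identityʳ x)
  where
  rest-false : ∀ i → b (suc i) ≡ false
  rest-false i = ¬-not λ bᵢ → 0≢1+n (unique zero (suc i) b₀ bᵢ)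
... | false = ∑-if-unique (b ∘ suc) x λ i j p q → Fin-suc-injective (unique (suc i) (suc j) p q)

guarded-choice : {A : Set} {P : A → ℕ → Set} (M : A → Bool) →
                 (∀ a → M a ≡ true → ∃ (P a)) → ∃ λ f → ∀ a → M a ≡ true → P a (f a)
guarded-choice {P = P} M h = (λ a → pick a (M a) refl) , (λ a → pick-spec a (M a) refl)
  where
  pick : ∀ a b → M a ≡ b → ℕ
  pick a true  p = proj₁ (h a p)
  pick a false _ = 0
  pick-spec : ∀ a b (p : M a ≡ b) → b ≡ true → P a (pick a b p)
  pick-spec a true p _ = proj₂ (h a p)

∧-true-left : ∀ {x y} → x ∧ y ≡ true → x ≡ true
∧-true-left {true} _ = refl

∧-true-right : ∀ {x y} → x ∧ y ≡ true → y ≡ true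
∧-true-right {true} p = p

if-not-true : ∀ b {x} → (if b then x else not x) ≡ true → x ≡ b
if-not-true true  p = p
if-not-true false {false} _ = refl

if-∧-split : ∀ a c (x : ℕ) →
             (if a ∧ c then x else 0) + (if a ∧ not c then x else 0) ≡ (if a then x else 0)
if-∧-split false c     x = refl
if-∧-split true  true  x = +-identityʳ x
if-∧-split true  false x = refl

residue-injective : ∀ {k} {i i′ : Fin k} j j′ → toℕ i + j * k ≡ toℕ i′ + j′ * k → i ≡ i′
residue-injective {suc k₀} {i} {i′} j j′ eq = toℕ-injective (begin
  toℕ i                          ≡⟨ sym (m<n⇒m%n≡m (toℕ<n i)) ⟩
  toℕ i % suc k₀                 ≡⟨ sym ([m+kn]%n≡m%n (toℕ i) j (suc k₀)) ⟩
  (toℕ i + j * suc k₀) % suc k₀   ≡⟨ cong (_% suc k₀) eq ⟩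
  (toℕ i′ + j′ * suc k₀) % suc k₀ ≡⟨ [m+kn]%n≡m%n (toℕ i′) j′ (suc k₀) ⟩
  toℕ i′ % suc k₀                ≡⟨ m<n⇒m%n≡m (toℕ<n i′) ⟩
  toℕ i′                         ∎)
  where open ≡-Reasoning

even : ℕ → Bool
even zero    = true
even (suc n) = not (even n)

even-suc-≢ : ∀ n → even (suc n) ≢ even n
even-suc-≢ n eq = not-¬ refl (sym eq)

module _ (G : WGraph) where
  open WGraph G

  Touch : Fin m → Fin m → Set
  Touch e f = ∃ λ x → Incident G e x × Incident G f x

  touch-refl : ∀ e → Touch e e
  touch-refl e = src e , inj₁ refl , inj₁ refl

  ⋃ : ∀ {k} → (Fin k → Fin m → Bool) → Fin m → Bool
  ⋃ S e = ⋁ (λ i → S i e)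

  Separated : ∀ {k} → (Fin k → Fin m → Bool) → Set
  Separated {k} S = ∀ (i i′ : Fin k) e f → S i e ≡ true → S i′ f ≡ true → Touch e f → i ≡ i′

  weight-split : ∀ M (c : Fin m → Bool) →
                 weight G M ≡ weight G (λ e → M e ∧ c e) + weight G (λ e → M e ∧ not (c e))
  weight-split M c = trans (∑-cong λ e → sym (if-∧-split (M e) (c e) (w e))) (∑-distrib-+ {m} _ _)

  weight-⋃ : ∀ {k} (S : Fin k → Fin m → Bool) →
             (∀ i i′ e → S i e ≡ true → S i′ e ≡ true → i ≡ i′) →
             ∑ k (λ i → weight G (S i)) ≡ weight G (⋃ S)
  weight-⋃ {k} S disjoint = trans (∑-comm {k} {m} _)
    (∑-cong λ e → ∑-if-unique (λ i → S i e) (w e) λ i i′ → disjoint i i′ e)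

  ⋁-true : ∀ {k} (b : Fin k → Bool) → ⋁ b ≡ true → ∃ λ i → b i ≡ true
  ⋁-true {suc k} b p with b zero in b₀
  ... | true  = zero , b₀
  ... | false = let i , bᵢ = ⋁-true (b ∘ suc) p in suc i , bᵢ

  ⊆-isMatching : ∀ {M N} → IsMatching G M → (∀ e → N e ≡ true → M e ≡ true) → IsMatching G N
  ⊆-isMatching M-matching N⊆M e f Ne Nf = M-matching e f (N⊆M e Ne) (N⊆M f Nf)

  ⋃-isMatching : ∀ {k} (S : Fin k → Fin m → Bool) →
                 (∀ i → IsMatching G (S i)) → Separated S → IsMatching G (⋃ S)
  ⋃-isMatching S S-matching separated e f Ue Uf e≢f x ex fx
    with ⋁-true (λ i → S i e) Ue | ⋁-true (λ i → S i f) Uf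
  ... | i , Sie | i′ , Si′f with separated i i′ e f Sie Si′f (x , ex , fx)
  ... | refl = S-matching i e f Sie Si′f e≢f x ex fx

module _ (G : WGraph) (v : Fin (WGraph.n G)) where
  open WGraph G

  Dist-unique : ∀ {u a b} → Dist G v u a → Dist G v u b → a ≡ b
  Dist-unique {a = a} {b} (walk-a , min-a) (walk-b , min-b) with <-cmp a b
  ... | tri< a<b _ _ = ⊥-elim (min-b a a<b walk-a)
  ... | tri≈ _ a≡b _ = a≡b
  ... | tri> _ _ b<a = ⊥-elim (min-a b b<a walk-b)

  endpoint-Dist : ∀ {L e x} → InE G v L e → Incident G e x → Dist G v x L ⊎ Dist G v x (suc L)
  endpoint-Dist (inj₁ (src-L , tgt-L+1)) (inj₁ refl) = inj₁ src-L
  endpoint-Dist (inj₁ (src-L , tgt-L+1)) (inj₂ refl) = inj₂ tgt-L+1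
  endpoint-Dist (inj₂ (tgt-L , src-L+1)) (inj₁ refl) = inj₂ src-L+1
  endpoint-Dist (inj₂ (tgt-L , src-L+1)) (inj₂ refl) = inj₁ tgt-L

  InE-touch : ∀ {L L′ e f} → InE G v L e → InE G v L′ f → Touch G e f →
              L ≡ L′ ⊎ L ≡ suc L′ ⊎ suc L ≡ L′
  InE-touch e∈L f∈L′ (x , ex , fx) = compare (endpoint-Dist e∈L ex) (endpoint-Dist f∈L′ fx)
    where
    compare : ∀ {L L′} → Dist G v x L ⊎ Dist G v x (suc L) → Dist G v x L′ ⊎ Dist G v x (suc L′) →
              L ≡ L′ ⊎ L ≡ suc L′ ⊎ suc L ≡ L′
    compare (inj₁ p) (inj₁ q) = inj₁ (Dist-unique p q)
    compare (inj₁ p) (inj₂ q) = inj₂ (inj₁ (Dist-unique p q))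
    compare (inj₂ p) (inj₁ q) = inj₂ (inj₂ (Dist-unique p q))
    compare (inj₂ p) (inj₂ q) = inj₁ (suc-injective (Dist-unique p q))

  InE-touch-even : ∀ {L L′ e f} → InE G v L e → InE G v L′ f → Touch G e f →
                   even L ≡ even L′ → L ≡ L′
  InE-touch-even {L} {L′} e∈L f∈L′ t same with InE-touch e∈L f∈L′ t
  ... | inj₁ L≡L′        = L≡L′
  ... | inj₂ (inj₁ refl) = ⊥-elim (even-suc-≢ L′ same)
  ... | inj₂ (inj₂ refl) = ⊥-elim (even-suc-≢ L (sym same))

module _ (G : WGraph) (v : Fin (WGraph.n G)) (r k : ℕ) (Ms : Fin k → Fin (WGraph.m G) → Bool)
         (Ms-matching : ∀ i → IsMatching G (Ms i))
         (Ms⊆F : ∀ i e → Ms i e ≡ true → InF G v r k (toℕ i) e) where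
  open WGraph G

  private
    level-choice : ∀ i → ∃ λ (j : Fin m → ℕ) → ∀ e → Ms i e ≡ true → InE G v (toℕ i + j e * k) e
    level-choice i = guarded-choice {P = λ e j → InE G v (toℕ i + j * k) e} (Ms i)
      λ e p → let j , _ , e∈E = Ms⊆F i e p in j , e∈E

  level : Fin k → Fin m → ℕ
  level i e = toℕ i + proj₁ (level-choice i) e * k

  level-InE : ∀ i e → Ms i e ≡ true → InE G v (level i e) e
  level-InE i = proj₂ (level-choice i)

  -- The guard is written so that byParity true i and byParity false i are literally the two
  -- halves in weight-split.
  byParity : Bool → Fin k → Fin m → Bool
  byParity b i e = Ms i e ∧ (if b then even (level i e) else not (even (level i e)))

  byParity-separated : ∀ b → Separated G (byParity b)
  byParity-separated b i i′ e f pe pf t =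
    residue-injective (proj₁ (level-choice i) e) (proj₁ (level-choice i′) f)
    (InE-touch-even G v (level-InE i e (∧-true-left pe)) (level-InE i′ f (∧-true-left pf)) t
      (trans (if-not-true b (∧-true-right pe)) (sym (if-not-true b (∧-true-right pf)))))

  ⋃-byParity-isMatching : ∀ b → IsMatching G (⋃ G (byParity b))
  ⋃-byParity-isMatching b = ⋃-isMatching G (byParity b)
    (λ i → ⊆-isMatching G (Ms-matching i) λ _ → ∧-true-left)
    (byParity-separated b)

  weight-byParity : ∀ b → ∑ k (λ i → weight G (byParity b i)) ≡ weight G (⋃ G (byParity b))
  weight-byParity b = weight-⋃ G (byParity b)
    λ i i′ e pe pe′ → byParity-separated b i i′ e e pe pe′ (touch-refl G e)

  ∑-weight≤2*bound : ∀ ν → (∀ M → IsMatching G M → weight G M ≤ ν) →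
                     ∑ k (λ i → weight G (Ms i)) ≤ 2 * ν
  ∑-weight≤2*bound ν bound = begin
    ∑ k (λ i → weight G (Ms i))
      ≡⟨ ∑-cong (λ i → weight-split G (Ms i) (even ∘ level i)) ⟩
    ∑ k (λ i → weight G (byParity true i) + weight G (byParity false i))
      ≡⟨ ∑-distrib-+ {k} _ _ ⟩
    ∑ k (λ i → weight G (byParity true i)) + ∑ k (λ i → weight G (byParity false i))
      ≡⟨ cong₂ _+_ (weight-byParity true) (weight-byParity false) ⟩
    weight G (⋃ G (byParity true)) + weight G (⋃ G (byParity false))
      ≤⟨ +-mono-≤ (bound _ (⋃-byParity-isMatching true)) (bound _ (⋃-byParity-isMatching false)) ⟩
    ν + ν
      ≡⟨ cong (ν +_) (sym (+-identityʳ ν)) ⟩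
    2 * ν ∎
    where open ≤-Reasoning

proposition6 : (G : WGraph) (v : Fin (WGraph.n G)) (r : ℕ) → NumLabels G v r →
    (k : ℕ) → 1 < k →
    (νG : ℕ) → IsNu G (AllEdges G) νG →
    (νGi : Fin k → ℕ) → (∀ i → IsNu G (InF G v r k (toℕ i)) (νGi i)) →
    ∑ k νGi ≤ 2 * νG
proposition6 G v r _ k _ νG (_ , νG-max) νGi νGi-attained = begin
  ∑ k νGi                          ≡⟨ ∑-cong (λ i → sym (weight-Ms i)) ⟩
  ∑ k (λ i → weight G (Ms i))      ≤⟨ ∑-weight≤2*bound G v r k Ms Ms-matching Ms⊆F νG
                                         (λ M M-matching → νG-max M M-matching λ _ _ → tt) ⟩
  2 * νG                           ∎
  where
  open ≤-Reasoning
  Ms = λ i → proj₁ (proj₁ (νGi-attained i))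
  Ms-matching = λ i → proj₁ (proj₂ (proj₁ (νGi-attained i)))
  Ms⊆F = λ i → proj₁ (proj₂ (proj₂ (proj₁ (νGi-attained i))))
  weight-Ms = λ i → proj₂ (proj₂ (proj₂ (proj₁ (νGi-attained i))))
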